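{- The cover graph of every finite upper locally distributive lattice admits a U-coloring.
   Context: The cover graph of a poset has an arc $(x,y)$ whenever $y$ covers $x$. For a digraph $D=(V,A)$, an arc coloring $c$ is a U-coloring if for all $u,v,w\in V$ with $u\neq w$ and $(v,u),(v,w)\in A$: (U$_1$) $c(v,u)\neq c(v,w)$; (U$_2$) there is $z\in V$ with arcs $(u,z),(w,z)\in A$ such that $c(v,u)=c(w,z)$ and $c(v,w)=c(u,z)$. A poset $P$ is an upper locally distributive lattice if $P$ is a lattice and there is a map $x\mapsto M_x$ assigning to each $x\in P$ a set $M_x$ of meet-irreducible elements with $x=\bigwedge M_x$ and such that whenever $x=\bigwedge B$ for a set $B$ of meet-irreducibles then $M_x\subseteq B$. -}

module Defs where

open import Data.Nat using (ℕ)
open import Data.Fin using (Fin)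
open import Data.Product using (Σ; ∃; ∃-syntax; _×_; _,_)
open import Data.Sum using (_⊎_)
open import Relation.Nullary using (¬_)
open import Relation.Unary using (Pred; _∈_; _⊆_)
open import Relation.Binary.Structures using (IsPartialOrder)
open import Relation.Binary.PropositionalEquality using (_≡_; _≢_)
open import Level using (0ℓ)

record FinitePoset : Set₁ where
  field
    n          : ℕ
    _≤_        : Fin n → Fin n → Set
    isPartialOrder : IsPartialOrder _≡_ _≤_

Digraph : Set → Set₁
Digraph V = V → V → Set

-- U-coloring of a digraph with colours from C; c assigns a colour to each
-- ordered pair, and only its values on arcs matter.
IsUColoring : {V C : Set} → Digraph V → (V → V → C) → Set
IsUColoring {V} A c =
  ∀ (u v w : V) → u ≢ w → A v u → A v w →
    (c v u ≢ c v w) ×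
    (∃[ z ] (A u z × A w z × c v u ≡ c w z × c v w ≡ c u z))

HasUColoring : {V : Set} → Digraph V → Set₁
HasUColoring {V} A = Σ Set λ C → Σ (V → V → C) λ c → IsUColoring A c

module _ (P : FinitePoset) where
  open FinitePoset P

  _<_ : Fin n → Fin n → Set
  x < y = x ≤ y × x ≢ y

  _⋖_ : Fin n → Fin n → Set
  x ⋖ y = x < y × ¬ (∃[ z ] (x < z × z < y))

  CoverGraph : Digraph (Fin n)
  CoverGraph x y = x ⋖ y

  IsMeet : Pred (Fin n) 0ℓ → Fin n → Set
  IsMeet B x = (∀ b → b ∈ B → x ≤ b) ×
               (∀ y → (∀ b → b ∈ B → y ≤ b) → y ≤ x)

  IsMeet₂ : Fin n → Fin n → Fin n → Set
  IsMeet₂ a b x = (x ≤ a × x ≤ b) × (∀ y → y ≤ a → y ≤ b → y ≤ x)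

  IsJoin₂ : Fin n → Fin n → Fin n → Set
  IsJoin₂ a b x = (a ≤ x × b ≤ x) × (∀ y → a ≤ y → b ≤ y → x ≤ y)

  IsLattice : Set
  IsLattice = ∀ a b → (∃[ m ] IsMeet₂ a b m) × (∃[ j ] IsJoin₂ a b j)

  MeetIrreducible : Fin n → Set
  MeetIrreducible m = ¬ (∀ y → y ≤ m) ×
                      (∀ a b → IsMeet₂ a b m → m ≡ a ⊎ m ≡ b)

  IsULD : Set₁
  IsULD = IsLattice ×
    Σ (Fin n → Pred (Fin n) 0ℓ) λ M →
      ∀ x → (M x ⊆ MeetIrreducible) ×
            IsMeet (M x) x ×
            (∀ (B : Pred (Fin n) 0ℓ) → B ⊆ MeetIrreducible → IsMeet B x → M x ⊆ B)

module Submission where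

open import Data.Bool using (true; false)
open import Data.Fin using (Fin; _≟_)
open import Data.Fin.Subset using (Subset)
open import Data.Product using (_×_; _,_; proj₁; proj₂; ∃-syntax)
open import Data.Sum using (_⊎_; inj₁; inj₂; [_,_])
open import Data.Vec using (tabulate; lookup)
open import Data.Vec.Properties using (lookup∘tabulate; tabulate-cong)
open import Function using (_∘_; id)
open import Function.Bundles using (mk⇔)
open import Level using (0ℓ)
open import Relation.Nullary using (¬_; Dec; yes; no; does; contradiction)
open import Relation.Nullary.Decidable using (map′; dec-true; dec-false; does-⇔; decidable-stable)
open import Relation.Unary using (Pred; _∈_; _⊆_; _∪_; ｛_｝)
open import Relation.Binary.PropositionalEquality using (_≡_; _≢_; refl; sym; trans; cong; subst; module ≡-Reasoning)
open import Relation.Binary.Structures using (IsPartialOrder)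
open import Defs

-- In an upper locally distributive lattice each x has a least representation
-- M x as a meet of meet-irreducibles, so M (a ∧ b) ⊆ M a ∪ M b.  For a cover
-- v ⋖ u this makes {a ≥ v : u ≰ a} closed under joins.  Colour the cover
-- v ⋖ u by the set {a : u ≤ a ∨ v}.  For distinct covers v ⋖ u, v ⋖ w the
-- colours differ at a = u; join-closedness shows that u ∨ w covers u and w,
-- and that the colour of v ⋖ u equals that of w ⋖ u ∨ w.

module Covers (P : FinitePoset) where
  open FinitePoset P

  _≺_ : Fin n → Fin n → Set
  _≺_ = _⋖_ P

  ≺-interval : ∀ {v u g} → v ≺ u → v ≤ g → g ≤ u → g ≡ v ⊎ g ≡ u
  ≺-interval {v} {u} {g} (_ , no-middle) v≤g g≤u with g ≟ v | g ≟ u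
  ... | yes g≡v | _       = inj₁ g≡v
  ... | no _    | yes g≡u = inj₂ g≡u
  ... | no g≢v  | no g≢u  =
    contradiction (g , (v≤g , g≢v ∘ sym) , (g≤u , g≢u)) no-middle

  ≺-distinct-incomparable : ∀ {v u w} → v ≺ u → v ≺ w → u ≢ w → ¬ u ≤ w
  ≺-distinct-incomparable ((v≤u , v≢u) , _) v≺w u≢w u≤w =
    [ v≢u ∘ sym , u≢w ] (≺-interval v≺w v≤u u≤w)

module LatticeOperations (P : FinitePoset) (lattice : IsLattice P) where
  open FinitePoset P
  open IsPartialOrder isPartialOrder using (antisym) renaming (refl to ≤-refl)
  open Covers P

  infixr 22 _∧_
  infixr 21 _∨_

  _∧_ _∨_ : Fin n → Fin n → Fin n
  a ∧ b = proj₁ (proj₁ (lattice a b))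
  a ∨ b = proj₁ (proj₂ (lattice a b))

  ∧-isMeet : ∀ a b → IsMeet₂ P a b (a ∧ b)
  ∧-isMeet a b = proj₂ (proj₁ (lattice a b))

  ∨-isJoin : ∀ a b → IsJoin₂ P a b (a ∨ b)
  ∨-isJoin a b = proj₂ (proj₂ (lattice a b))

  x∧y≤x : ∀ a b → a ∧ b ≤ a
  x∧y≤x a b = proj₁ (proj₁ (∧-isMeet a b))

  x∧y≤y : ∀ a b → a ∧ b ≤ b
  x∧y≤y a b = proj₂ (proj₁ (∧-isMeet a b))

  ∧-greatest : ∀ {a b c} → c ≤ a → c ≤ b → c ≤ a ∧ b
  ∧-greatest {a} {b} {c} = proj₂ (∧-isMeet a b) c

  x≤x∨y : ∀ a b → a ≤ a ∨ b
  x≤x∨y a b = proj₁ (proj₁ (∨-isJoin a b))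

  y≤x∨y : ∀ a b → b ≤ a ∨ b
  y≤x∨y a b = proj₂ (proj₁ (∨-isJoin a b))

  ∨-least : ∀ {a b c} → a ≤ c → b ≤ c → a ∨ b ≤ c
  ∨-least {a} {b} {c} = proj₂ (∨-isJoin a b) c

  ∨-comm : ∀ a b → a ∨ b ≡ b ∨ a
  ∨-comm a b = antisym (∨-least (y≤x∨y b a) (x≤x∨y b a)) (∨-least (y≤x∨y a b) (x≤x∨y a b))

  _≤?_ : ∀ a b → Dec (a ≤ b)
  a ≤? b = map′ (λ a∨b≡b → subst (a ≤_) a∨b≡b (x≤x∨y a b))
                (λ a≤b → antisym (∨-least a≤b ≤-refl) (y≤x∨y a b))
                (a ∨ b ≟ b)

  ≤-stable : ∀ {a b} → ¬ ¬ a ≤ b → a ≤ b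
  ≤-stable {a} {b} = decidable-stable (a ≤? b)

  ≺-isMeet : ∀ {v u c} → v ≺ u → v ≤ c → ¬ u ≤ c → IsMeet₂ P u c v
  ≺-isMeet {v} {u} {c} v≺u@((v≤u , _) , _) v≤c u≰c =
    (v≤u , v≤c) , λ y y≤u y≤c → [ (λ u∧c≡v → subst (y ≤_) u∧c≡v (∧-greatest y≤u y≤c))
                                , (λ u∧c≡u → contradiction (subst (_≤ c) u∧c≡u (x∧y≤y u c)) u≰c) ]
                                (≺-interval v≺u (∧-greatest v≤u v≤c) (x∧y≤x u c))

module UpperLocallyDistributive (P : FinitePoset) (uld : IsULD P) where
  open FinitePoset P
  open IsPartialOrder isPartialOrder using (antisym) renaming (refl to ≤-refl; trans to ≤-trans)
  open Covers P
  open LatticeOperations P (proj₁ uld) public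

  M : Fin n → Pred (Fin n) 0ℓ
  M = proj₁ (proj₂ uld)

  M⊆MeetIrreducible : ∀ x → M x ⊆ MeetIrreducible P
  M⊆MeetIrreducible x = proj₁ (proj₂ (proj₂ uld) x)

  M-isMeet : ∀ x → IsMeet P (M x) x
  M-isMeet x = proj₁ (proj₂ (proj₂ (proj₂ uld) x))

  M-minimal : ∀ {x} B → B ⊆ MeetIrreducible P → IsMeet P B x → M x ⊆ B
  M-minimal {x} = proj₂ (proj₂ (proj₂ (proj₂ uld) x))

  ≤-M : ∀ {x k} → k ∈ M x → x ≤ k
  ≤-M {x} {k} = proj₁ (M-isMeet x) k

  M-greatest : ∀ {x y} → (∀ {k} → k ∈ M x → y ≤ k) → y ≤ x
  M-greatest {x} {y} y≤M = proj₂ (M-isMeet x) y (λ _ → y≤M)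

  M-irreducible : ∀ {m} → MeetIrreducible P m → M m ⊆ ｛ m ｝
  M-irreducible {m} m-irr =
    M-minimal ｛ m ｝ (λ { refl → m-irr }) ((λ { _ refl → ≤-refl }) , λ y y≤m → y≤m m refl)

  M-meet : ∀ {a b x} → IsMeet₂ P a b x → M x ⊆ M a ∪ M b
  M-meet {a} {b} ((x≤a , x≤b) , greatest) =
    M-minimal (M a ∪ M b) [ M⊆MeetIrreducible a , M⊆MeetIrreducible b ]
      ( (λ _ → [ ≤-trans x≤a ∘ ≤-M , ≤-trans x≤b ∘ ≤-M ])
      , λ y y≤M → greatest y (M-greatest (y≤M _ ∘ inj₁)) (M-greatest (y≤M _ ∘ inj₂)) )

  ≺-M-inherited : ∀ {v u a k} → v ≺ u → v ≤ a → ¬ u ≤ a → k ∈ M v → ¬ u ≤ k → k ∈ M a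
  ≺-M-inherited v≺u v≤a u≰a k∈Mv u≰k =
    [ (λ k∈Mu → contradiction (≤-M k∈Mu) u≰k) , id ] (M-meet (≺-isMeet v≺u v≤a u≰a) k∈Mv)

  ≺-M-not-all-above : ∀ {v u} → v ≺ u → ¬ (∀ {k} → k ∈ M v → ¬ ¬ u ≤ k)
  ≺-M-not-all-above ((v≤u , v≢u) , _) u≤M = v≢u (antisym v≤u (M-greatest (≤-stable ∘ u≤M)))

  ≺-avoiders-join-closed : ∀ {v u a b} → v ≺ u → v ≤ a → v ≤ b → ¬ u ≤ a → ¬ u ≤ b → ¬ u ≤ a ∨ b
  ≺-avoiders-join-closed v≺u v≤a v≤b u≰a u≰b u≤a∨b =
    ≺-M-not-all-above v≺u λ k∈Mv u≰k →
      u≰k (≤-trans u≤a∨b (∨-least (≤-M (≺-M-inherited v≺u v≤a u≰a k∈Mv u≰k))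
                                  (≤-M (≺-M-inherited v≺u v≤b u≰b k∈Mv u≰k))))

  -- For m ∈ M u with t ≰ m, any k ∈ M v with w ≰ k lies in M m = {m} and in M t.
  ≺-join-interval : ∀ {v u w t} → v ≺ u → v ≺ w → u ≤ t → t ≤ u ∨ w → ¬ w ≤ t → t ≤ u
  ≺-join-interval {u = u} {t = t} ((v≤u , _) , _) v≺w@((v≤w , _) , _) u≤t t≤u∨w w≰t =
    M-greatest λ {m} m∈Mu → ≤-stable λ t≰m →
      let v≤m = ≤-trans v≤u (≤-M m∈Mu)
          w≰m = λ w≤m → t≰m (≤-trans t≤u∨w (∨-least (≤-M m∈Mu) w≤m))
      in ≺-M-not-all-above v≺w λ k∈Mv w≰k →
           t≰m (subst (t ≤_) (sym (M-irreducible (M⊆MeetIrreducible u m∈Mu)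
                                                 (≺-M-inherited v≺w v≤m w≰m k∈Mv w≰k)))
                             (≤-M (≺-M-inherited v≺w (≤-trans v≤u u≤t) w≰t k∈Mv w≰k)))

  ≺-join : ∀ {v u w} → v ≺ u → v ≺ w → u ≢ w → u ≺ u ∨ w
  ≺-join {u = u} {w = w} v≺u v≺w u≢w = (x≤x∨y u w , u≢u∨w) , no-middle
    where
      u≢u∨w : u ≢ u ∨ w
      u≢u∨w u≡u∨w = ≺-distinct-incomparable v≺w v≺u (u≢w ∘ sym)
                      (subst (w ≤_) (sym u≡u∨w) (y≤x∨y u w))
      no-middle : ¬ (∃[ t ] (_<_ P u t × _<_ P t (u ∨ w)))
      no-middle (t , (u≤t , u≢t) , (t≤u∨w , t≢u∨w)) =
        t≢u∨w (antisym t≤u∨w (∨-least u≤t (≤-stable λ w≰t →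
          u≢t (antisym u≤t (≺-join-interval v≺u v≺w u≤t t≤u∨w w≰t)))))

  colour : Fin n → Fin n → Subset n
  colour v u = tabulate λ a → does (u ≤? a ∨ v)

  colour-distinct : ∀ {v u w} → v ≺ u → v ≺ w → u ≢ w → colour v u ≢ colour v w
  colour-distinct {v} {u} {w} v≺u@((v≤u , _) , _) v≺w u≢w same = contradiction true≡false λ ()
    where
      open ≡-Reasoning
      w≰u∨v : ¬ w ≤ u ∨ v
      w≰u∨v w≤u∨v = ≺-distinct-incomparable v≺w v≺u (u≢w ∘ sym)
                      (≤-trans w≤u∨v (∨-least ≤-refl v≤u))
      true≡false : true ≡ false
      true≡false = begin
        true                  ≡⟨ dec-true (u ≤? u ∨ v) (x≤x∨y u v) ⟨
        does (u ≤? u ∨ v)     ≡⟨ lookup∘tabulate _ u ⟨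
        lookup (colour v u) u ≡⟨ cong (λ c → lookup c u) same ⟩
        lookup (colour v w) u ≡⟨ lookup∘tabulate _ u ⟩
        does (w ≤? u ∨ v)     ≡⟨ dec-false (w ≤? u ∨ v) w≰u∨v ⟩
        false                 ∎

  colour-transport : ∀ {v u w} → v ≺ u → v ≺ w → u ≢ w → colour v u ≡ colour w (u ∨ w)
  colour-transport {v} {u} {w} v≺u v≺w@((v≤w , _) , _) u≢w =
    tabulate-cong λ a → does-⇔ (mk⇔ (to a) (from a)) (u ≤? a ∨ v) (u ∨ w ≤? a ∨ w)
    where
      to : ∀ a → u ≤ a ∨ v → u ∨ w ≤ a ∨ w
      to a u≤a∨v = ∨-least (≤-trans u≤a∨v (∨-least (x≤x∨y a w) (≤-trans v≤w (y≤x∨y a w))))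
                           (y≤x∨y a w)
      from : ∀ a → u ∨ w ≤ a ∨ w → u ≤ a ∨ v
      from a u∨w≤a∨w = ≤-stable λ u≰a∨v →
        ≺-avoiders-join-closed v≺u (y≤x∨y a v) v≤w u≰a∨v (≺-distinct-incomparable v≺u v≺w u≢w)
          (≤-trans (x≤x∨y u w) (≤-trans u∨w≤a∨w
            (∨-least (≤-trans (x≤x∨y a v) (x≤x∨y (a ∨ v) w)) (y≤x∨y (a ∨ v) w))))

theorem4 : (P : FinitePoset) → IsULD P → HasUColoring (CoverGraph P)
theorem4 P uld = Subset n , colour , λ u v w u≢w v≺u v≺w →
    colour-distinct v≺u v≺w u≢w
  , ( u ∨ w
    , ≺-join v≺u v≺w u≢w
    , subst (w ≺_) (∨-comm w u) (≺-join v≺w v≺u (u≢w ∘ sym))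
    , colour-transport v≺u v≺w u≢w
    , trans (colour-transport v≺w v≺u (u≢w ∘ sym)) (cong (colour u) (∨-comm w u)) )
  where
    open FinitePoset P using (n)
    open Covers P using (_≺_)
    open UpperLocallyDistributive P uld
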